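{- Let $p$ be an odd prime, $N\ge1$ an integer and $\mathcal V=\mathcal V(p,N)$, and let $A=\frac1{\#\mathcal V^2}\sum_{\alpha,\beta\in\mathcal V}\mathfrak d_{p,N}(\alpha,\beta)^2$. Then \[ \frac1{\#\mathcal V^2}\sum_{\alpha\in\mathcal V}\sum_{\beta\in\mathcal V}\big(\mathfrak d_{p,N}(\alpha,\beta)^2-A\big)^2=\frac1{4(p-1)}\big(1-p^{ -2}-4p^{ -3}-3p^{ -4}\big). \]
   Context: $\omega=\exp(2\pi i/p)$; $\mathcal V(p,N)=\{\sum_{j=1}^{p-1}a_j\omega^j: a_j\in\{ -N,N\}\}$. For $\gamma\in\mathbb{Q}(\omega)$, $\mathrm{Tr}(\gamma)=\sum_{\sigma\in\mathrm{Gal}(\mathbb{Q}(\omega)/\mathbb{Q})}\sigma(\gamma)$, $\|\gamma\|=\big(\sum_{j=1}^{p-1}\mathrm{Tr}(\gamma\omega^j)^2\big)^{1/2}$, $\mathfrak d_{p,N}(\alpha,\beta)=\|\beta-\alpha\|/(2Np(p-1)^{1/2})$. -}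

module Defs where

open import Data.Bool using (Bool; true; false; if_then_else_)
open import Data.Nat as ℕ using (ℕ; zero; suc; _∸_)
open import Data.Nat.Divisibility using (_∣?_)
open import Data.Integer as ℤ using (+_)
open import Data.Rational as ℚ using (ℚ; 0ℚ; 1ℚ; _+_; _*_; _-_; -_; _÷_)
open import Data.Rational.Properties using (_≟_)
open import Data.Fin using (Fin; toℕ)
open import Data.Vec using (Vec; []; _∷_; lookup)
open import Data.List as List using (List; []; _∷_; length)
open import Relation.Nullary using (yes; no; does)

ℕ→ℚ : ℕ → ℚ
ℕ→ℚ n = + n ℚ./ 1

-- total division on ℚ (x / 0 := 0); only ever used with nonzero denominators
infixl 7 _⊘_
_⊘_ : ℚ → ℚ → ℚ
x ⊘ y with y ≟ 0ℚ
... | yes _ = 0ℚ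
... | no y≢0 = _÷_ x y {{ℚ.≢-nonZero y≢0}}

ΣFin : (m : ℕ) → (Fin m → ℚ) → ℚ
ΣFin zero    f = 0ℚ
ΣFin (suc m) f = f Fin.zero + ΣFin m (λ i → f (Fin.suc i))

ΣList : {A : Set} → List A → (A → ℚ) → ℚ
ΣList []       f = 0ℚ
ΣList (x ∷ xs) f = f x + ΣList xs f

-- Tr_{Q(ω)/Q}(ω^e) for ω = exp(2πi/p): p-1 if p ∣ e, else -1
trPow : (p e : ℕ) → ℚ
trPow p e = if does (p ∣? e) then ℕ→ℚ (p ∸ 1) else - 1ℚ

-- An element γ = Σ_{j=1}^{p-1} c_j ω^j of Q(ω) is represented by its
-- coefficient function c : Fin (p-1) → ℚ, index i standing for j = toℕ i + 1.

-- Tr(γ ω^e), by Q-linearity of the trace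
trTimesPow : (p : ℕ) → (Fin (p ∸ 1) → ℚ) → ℕ → ℚ
trTimesPow p c e = ΣFin (p ∸ 1) (λ i → c i * trPow p (suc (toℕ i) ℕ.+ e))

-- ‖γ‖² = Σ_{j=1}^{p-1} Tr(γ ω^j)²
normSq : (p : ℕ) → (Fin (p ∸ 1) → ℚ) → ℚ
normSq p c = ΣFin (p ∸ 1) (λ j → let t = trTimesPow p c (suc (toℕ j)) in t * t)

-- the element Σ_j a_j ω^j of V(p,N) with a_j = N if s_j = true, -N otherwise
vElem : (p N : ℕ) → Vec Bool (p ∸ 1) → Fin (p ∸ 1) → ℚ
vElem p N s i = if lookup s i then ℕ→ℚ N else - ℕ→ℚ N

allSigns : (m : ℕ) → List (Vec Bool m)
allSigns zero    = [] ∷ []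
allSigns (suc m) = List.map (true ∷_) (allSigns m) List.++ List.map (false ∷_) (allSigns m)

-- d_{p,N}(α,β)² = ‖β-α‖² / (2Np(p-1)^{1/2})² = ‖β-α‖² / (4 N² p² (p-1))
dSq : (p N : ℕ) → (α β : Fin (p ∸ 1) → ℚ) → ℚ
dSq p N α β = normSq p (λ i → β i - α i)
              ⊘ (ℕ→ℚ 4 * ℕ→ℚ N * ℕ→ℚ N * ℕ→ℚ p * ℕ→ℚ p * ℕ→ℚ (p ∸ 1))

cardV : (p : ℕ) → ℚ
cardV p = ℕ→ℚ (length (allSigns (p ∸ 1)))

meanDSq : (p N : ℕ) → ℚ
meanDSq p N = ΣList (allSigns (p ∸ 1)) (λ s → ΣList (allSigns (p ∸ 1)) (λ t →
                dSq p N (vElem p N s) (vElem p N t)))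
              ⊘ (cardV p * cardV p)

varDSq : (p N : ℕ) → ℚ
varDSq p N = ΣList (allSigns (p ∸ 1)) (λ s → ΣList (allSigns (p ∸ 1)) (λ t →
               let x = dSq p N (vElem p N s) (vElem p N t) - meanDSq p N in x * x))
             ⊘ (cardV p * cardV p)

rhs : (p : ℕ) → ℚ
rhs p = (1ℚ ⊘ (ℕ→ℚ 4 * ℕ→ℚ (p ∸ 1)))
        * (1ℚ - 1ℚ ⊘ (P * P) - ℕ→ℚ 4 ⊘ (P * P * P) - ℕ→ℚ 3 ⊘ (P * P * P * P))
  where P = ℕ→ℚ p

module Submission where

-- Write β − α = 2N Δ with Δⱼ ∈ {0, ±1}. Since Tr(ωᵉ) = p [p ∣ e] − 1, the trace of
-- (β − α) ωʲ is 2N (p Δ_{p−j} − ΣΔ), so ‖β − α‖² = 4N² (p² ΣΔ² − (p + 1) (ΣΔ)²) and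
-- d² = a ΣΔ² + b (ΣΔ)² with a = 1/(p − 1), b = −(p + 1)/(p² (p − 1)). For uniformly
-- random α, β the Δⱼ are independent and take the values 0, −1, 1, 0 with equal weight.
-- Adding a coordinate maps the family a ΣΔ² + b (ΣΔ + y)² + γ into itself, so its mean
-- and second moment obey a recursion in the number of coordinates, solved by explicit
-- polynomials. The variance of d² comes out as (p − 1)/4 · ((a + b)² + 2b² (p − 2)), and
-- (p² − p − 1)² + 2 (p + 1)² (p − 2) = p⁴ − p² − 4p − 3 turns it into the claimed value.

open import Defs
open import Data.Nat using (ℕ; _≤_)
open import Data.Nat.Primality using (Prime)
open import Data.Nat.Divisibility using (_∣_)
open import Relation.Nullary using (¬_)
open import Relation.Binary.PropositionalEquality using (_≡_)

open import Algebra.Bundles using (CommutativeRing)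
open import Data.Bool using (Bool; true; false; if_then_else_)
open import Data.Empty using (⊥-elim)
open import Data.Fin as Fin using (Fin; toℕ; opposite)
import Data.Fin.Properties as FinP
open import Data.Fin.Permutation using (reverse)
import Data.Integer as ℤ
import Data.Integer.Properties as ℤP
open import Data.List as List using (List; []; _∷_; length)
import Data.List.Properties as ListP
open import Data.Nat as ℕ using (zero; suc; s≤s; _<_; _∸_; _^_)
open import Data.Nat.Divisibility using (divides; _∣?_; ∣-refl)
import Data.Nat.Coprimality as Coprimality
open import Data.Nat.Primality using (¬prime[0]; ¬prime[1])
import Data.Nat.Properties as ℕP
open import Data.Rational as ℚ using (ℚ; 0ℚ; 1ℚ; ½; _+_; _*_; _-_; -_; 1/_)
open import Data.Rational.Properties as ℚP using (+-*-commutativeRing; _≟_)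
open import Data.Vec as Vec using (Vec; lookup)
open import Function using (_∘_; _⇔_; mk⇔; Equivalence)
open import Level using (0ℓ)
open import Relation.Binary.PropositionalEquality
  using (refl; sym; trans; cong; cong₂; subst; _≢_; ≢-sym; module ≡-Reasoning)
open import Relation.Nullary using (yes; no)
open import Relation.Nullary.Decidable using (does; does-⇔; dec⇒maybe)
import Tactic.RingSolver as Solver
import Tactic.RingSolver.Core.AlmostCommutativeRing as ACR

open import Algebra.Properties.Semiring.Sum (CommutativeRing.semiring +-*-commutativeRing)
  using (sum; sum-cong-≗; ∑-distrib-+; *-distribˡ-sum; *-distribʳ-sum; ∑-permute)

open ≡-Reasoning

ℚ-ring : ACR.AlmostCommutativeRing 0ℓ 0ℓ
ℚ-ring = ACR.fromCommutativeRing +-*-commutativeRing (dec⇒maybe ∘ (0ℚ ≟_))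

ℕ→ℚ-suc : ∀ n → ℕ→ℚ (suc n) ≡ 1ℚ + ℕ→ℚ n
ℕ→ℚ-suc n = begin
  ℤ.+ suc n ℚ./ 1
    ≡⟨ cong (ℚ._/ 1) (cong (λ k → ℤ.+ 1 ℤ.+ k) (sym (ℤP.*-identityʳ (ℤ.+ n)))) ⟩
  (ℤ.+ 1 ℤ.+ ℤ.+ n ℤ.* ℤ.+ 1) ℚ./ 1
    ≡⟨⟩
  1ℚ + ℚ.mkℚ (ℤ.+ n) 0 coprime
    ≡⟨ cong (1ℚ +_) (sym (ℚP.normalize-coprime coprime)) ⟩
  1ℚ + ℕ→ℚ n ∎
  where coprime = Coprimality.sym (Coprimality.1-coprimeTo n)

ℕ→ℚ≢0 : ∀ n .{{_ : ℕ.NonZero n}} → ℕ→ℚ n ≢ 0ℚ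
ℕ→ℚ≢0 n = ≢-sym (ℚP.<⇒≢ (ℚP.positive⁻¹ (ℕ→ℚ n) {{ℚP.normalize-pos n 1}}))

x+n*x≡[1+n]*x : ∀ n x → x + ℕ→ℚ n * x ≡ ℕ→ℚ (suc n) * x
x+n*x≡[1+n]*x n x = begin
  x + ℕ→ℚ n * x          ≡⟨ cong (_+ ℕ→ℚ n * x) (sym (ℚP.*-identityˡ x)) ⟩
  1ℚ * x + ℕ→ℚ n * x     ≡⟨ sym (ℚP.*-distribʳ-+ x 1ℚ (ℕ→ℚ n)) ⟩
  (1ℚ + ℕ→ℚ n) * x       ≡⟨ cong (_* x) (sym (ℕ→ℚ-suc n)) ⟩
  ℕ→ℚ (suc n) * x        ∎

⊘-unique : ∀ {x y z} → y ≢ 0ℚ → z * y ≡ x → x ⊘ y ≡ z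
⊘-unique {y = y} {z} y≢0 refl with y ≟ 0ℚ
... | yes y≡0 = ⊥-elim (y≢0 y≡0)
... | no y≢0′ = begin
  z * y * 1/ y     ≡⟨ ℚP.*-assoc z y (1/ y) ⟩
  z * (y * 1/ y)   ≡⟨ cong (z *_) (ℚP.*-inverseʳ y) ⟩
  z * 1ℚ           ≡⟨ ℚP.*-identityʳ z ⟩
  z                ∎
  where instance _ = ℚ.≢-nonZero y≢0′

⊘-inverseˡ : ∀ {y} → y ≢ 0ℚ → (1ℚ ⊘ y) * y ≡ 1ℚ
⊘-inverseˡ {y} y≢0 with y ≟ 0ℚ
... | yes y≡0 = ⊥-elim (y≢0 y≡0)
... | no y≢0′ = trans (cong (_* y) (ℚP.*-identityˡ (1/ y))) (ℚP.*-inverseˡ y)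
  where instance _ = ℚ.≢-nonZero y≢0′

*-≢0 : ∀ {x y} → x ≢ 0ℚ → y ≢ 0ℚ → x * y ≢ 0ℚ
*-≢0 {x} {y} x≢0 y≢0 xy≡0 = x≢0 (begin
  x              ≡⟨ sym (⊘-unique y≢0 refl) ⟩
  (x * y) ⊘ y    ≡⟨ cong (_⊘ y) xy≡0 ⟩
  0ℚ ⊘ y         ≡⟨ ⊘-unique y≢0 (ℚP.*-zeroˡ y) ⟩
  0ℚ             ∎)

ΣFin≡sum : ∀ m (f : Fin m → ℚ) → ΣFin m f ≡ sum f
ΣFin≡sum zero    f = refl
ΣFin≡sum (suc m) f = cong (f Fin.zero +_) (ΣFin≡sum m (f ∘ Fin.suc))

sum-const : ∀ m x → sum {m} (λ _ → x) ≡ ℕ→ℚ m * x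
sum-const zero    x = sym (ℚP.*-zeroˡ x)
sum-const (suc m) x = trans (cong (x +_) (sum-const m x)) (x+n*x≡[1+n]*x m x)

sum-affine² : ∀ {m} a b (f : Fin m → ℚ) →
  sum (λ i → (a * f i + b) * (a * f i + b))
    ≡ a * a * sum (λ i → f i * f i) + ℕ→ℚ 2 * a * b * sum f + ℕ→ℚ m * (b * b)
sum-affine² {m} a b f = begin
  sum (λ i → (a * f i + b) * (a * f i + b))
    ≡⟨ sum-cong-≗ (λ i → expand (f i)) ⟩
  sum (λ i → a * a * (f i * f i) + ℕ→ℚ 2 * a * b * f i + b * b)
    ≡⟨ ∑-distrib-+ (λ i → a * a * (f i * f i) + ℕ→ℚ 2 * a * b * f i) (λ _ → b * b) ⟩
  sum (λ i → a * a * (f i * f i) + ℕ→ℚ 2 * a * b * f i) + sum {m} (λ _ → b * b)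
    ≡⟨ cong₂ _+_ (∑-distrib-+ (λ i → a * a * (f i * f i)) (λ i → ℕ→ℚ 2 * a * b * f i))
                 (sum-const m (b * b)) ⟩
  sum (λ i → a * a * (f i * f i)) + sum (λ i → ℕ→ℚ 2 * a * b * f i) + ℕ→ℚ m * (b * b)
    ≡⟨ cong₂ (λ u v → u + v + ℕ→ℚ m * (b * b))
             (sym (*-distribˡ-sum (a * a) (λ i → f i * f i))) (sym (*-distribˡ-sum (ℕ→ℚ 2 * a * b) f)) ⟩
  a * a * sum (λ i → f i * f i) + ℕ→ℚ 2 * a * b * sum f + ℕ→ℚ m * (b * b) ∎
  where
  expand : ∀ x → (a * x + b) * (a * x + b) ≡ a * a * (x * x) + ℕ→ℚ 2 * a * b * x + b * b
  expand x = Solver.solve (a ∷ b ∷ x ∷ []) ℚ-ring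

δ : ∀ {m} → Fin m → Fin m → ℚ
δ i k = if does (i FinP.≟ k) then 1ℚ else 0ℚ

sum-δ : ∀ {m} (f : Fin m → ℚ) k → sum (λ i → f i * δ i k) ≡ f k
sum-δ f Fin.zero = begin
  f Fin.zero * 1ℚ + sum (λ i → f (Fin.suc i) * 0ℚ)
    ≡⟨ cong₂ _+_ (ℚP.*-identityʳ (f Fin.zero)) (sym (*-distribʳ-sum 0ℚ (f ∘ Fin.suc))) ⟩
  f Fin.zero + sum (f ∘ Fin.suc) * 0ℚ
    ≡⟨ cong (f Fin.zero +_) (ℚP.*-zeroʳ (sum (f ∘ Fin.suc))) ⟩
  f Fin.zero + 0ℚ
    ≡⟨ ℚP.+-identityʳ (f Fin.zero) ⟩
  f Fin.zero ∎
sum-δ f (Fin.suc k) = begin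
  f Fin.zero * 0ℚ + sum (λ i → f (Fin.suc i) * δ i k)
    ≡⟨ cong₂ _+_ (ℚP.*-zeroʳ (f Fin.zero)) (sum-δ (f ∘ Fin.suc) k) ⟩
  0ℚ + f (Fin.suc k)
    ≡⟨ ℚP.+-identityˡ (f (Fin.suc k)) ⟩
  f (Fin.suc k) ∎

ΣList-cong : ∀ {A : Set} (xs : List A) {f g : A → ℚ} → (∀ x → f x ≡ g x) → ΣList xs f ≡ ΣList xs g
ΣList-cong []       f≗g = refl
ΣList-cong (x ∷ xs) f≗g = cong₂ _+_ (f≗g x) (ΣList-cong xs f≗g)

ΣList-++ : ∀ {A : Set} (xs ys : List A) (f : A → ℚ) → ΣList (xs List.++ ys) f ≡ ΣList xs f + ΣList ys f
ΣList-++ []       ys f = sym (ℚP.+-identityˡ (ΣList ys f))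
ΣList-++ (x ∷ xs) ys f =
  trans (cong (f x +_) (ΣList-++ xs ys f)) (sym (ℚP.+-assoc (f x) (ΣList xs f) (ΣList ys f)))

ΣList-map : ∀ {A B : Set} (g : A → B) (xs : List A) (f : B → ℚ) →
  ΣList (List.map g xs) f ≡ ΣList xs (f ∘ g)
ΣList-map g []       f = refl
ΣList-map g (x ∷ xs) f = cong (f (g x) +_) (ΣList-map g xs f)

ΣList-+ : ∀ {A : Set} (xs : List A) (f g : A → ℚ) → ΣList xs (λ x → f x + g x) ≡ ΣList xs f + ΣList xs g
ΣList-+ []       f g = sym (ℚP.+-identityˡ 0ℚ)
ΣList-+ (x ∷ xs) f g =
  trans (cong (f x + g x +_) (ΣList-+ xs f g)) (interchange (f x) (g x) (ΣList xs f) (ΣList xs g))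
  where
  interchange : ∀ a b c d → a + b + (c + d) ≡ a + c + (b + d)
  interchange = Solver.solve-∀ ℚ-ring

ΣList-const : ∀ {A : Set} (xs : List A) x → ΣList xs (λ _ → x) ≡ ℕ→ℚ (length xs) * x
ΣList-const []       x = sym (ℚP.*-zeroˡ x)
ΣList-const (_ ∷ xs) x = trans (cong (x +_) (ΣList-const xs x)) (x+n*x≡[1+n]*x (length xs) x)

m∣1+n∧1+n<m+m⇒1+n≡m : ∀ {m n} → m ∣ suc n → suc n < m ℕ.+ m → suc n ≡ m
m∣1+n∧1+n<m+m⇒1+n≡m (divides zero ())                _
m∣1+n∧1+n<m+m⇒1+n≡m (divides (suc zero) eq)           _ = trans eq (ℕP.*-identityˡ _)
m∣1+n∧1+n<m+m⇒1+n≡m {m} (divides (suc (suc q)) eq) 1+n<m+m =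
  ⊥-elim (ℕP.<⇒≱ 1+n<m+m (subst (m ℕ.+ m ≤_) (sym eq) (ℕP.+-monoʳ-≤ m (ℕP.m≤m+n m (q ℕ.* m)))))

i+1+j≡m⇔i≡opposite : ∀ {m} (i j : Fin m) → toℕ i ℕ.+ suc (toℕ j) ≡ m ⇔ i ≡ opposite j
i+1+j≡m⇔i≡opposite {m} i j = mk⇔
  (λ i+1+j≡m → FinP.toℕ-injective
     (ℕP.+-cancelʳ-≡ (suc (toℕ j)) (toℕ i) _ (trans i+1+j≡m (sym opposite+1+j≡m))))
  (λ { refl → opposite+1+j≡m })
  where
  opposite+1+j≡m : toℕ (opposite j) ℕ.+ suc (toℕ j) ≡ m
  opposite+1+j≡m = trans (cong (ℕ._+ suc (toℕ j)) (FinP.opposite-prop j)) (ℕP.m∸n+n≡m (FinP.toℕ<n j))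

-- Both summands lie in [1, m], so the only multiple of m + 1 they can add up to is m + 1.
1+m∣1+i+1+j⇔i≡opposite : ∀ {m} (i j : Fin m) → suc m ∣ suc (toℕ i) ℕ.+ suc (toℕ j) ⇔ i ≡ opposite j
1+m∣1+i+1+j⇔i≡opposite {m} i j = mk⇔
  (λ 1+m∣ → Equivalence.to (i+1+j≡m⇔i≡opposite i j) (ℕP.suc-injective (m∣1+n∧1+n<m+m⇒1+n≡m 1+m∣ bound)))
  (λ i≡opposite →
     subst (suc m ∣_) (sym (cong suc (Equivalence.from (i+1+j≡m⇔i≡opposite i j) i≡opposite))) ∣-refl)
  where
  bound : suc (toℕ i) ℕ.+ suc (toℕ j) < suc m ℕ.+ suc m
  bound = ℕP.+-mono-< (s≤s (FinP.toℕ<n i)) (s≤s (FinP.toℕ<n j))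

trPow-δ : ∀ {m} (i j : Fin m) →
  trPow (suc m) (suc (toℕ i) ℕ.+ suc (toℕ j)) ≡ ℕ→ℚ (suc m) * δ i (opposite j) - 1ℚ
trPow-δ {m} i j = begin
  (if does (suc m ∣? e) then ℕ→ℚ m else - 1ℚ)
    ≡⟨ cong (λ b → if b then ℕ→ℚ m else - 1ℚ)
            (does-⇔ (1+m∣1+i+1+j⇔i≡opposite i j) (suc m ∣? e) (i FinP.≟ opposite j)) ⟩
  (if does (i FinP.≟ opposite j) then ℕ→ℚ m else - 1ℚ)
    ≡⟨ trace-value (does (i FinP.≟ opposite j)) ⟩
  ℕ→ℚ (suc m) * δ i (opposite j) - 1ℚ ∎
  where
  e = suc (toℕ i) ℕ.+ suc (toℕ j)
  trace-value : ∀ b → (if b then ℕ→ℚ m else - 1ℚ) ≡ ℕ→ℚ (suc m) * (if b then 1ℚ else 0ℚ) - 1ℚ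
  trace-value true = begin
    ℕ→ℚ m                       ≡⟨ pred-form (ℕ→ℚ m) ⟩
    (1ℚ + ℕ→ℚ m) * 1ℚ - 1ℚ      ≡⟨ cong (λ x → x * 1ℚ - 1ℚ) (sym (ℕ→ℚ-suc m)) ⟩
    ℕ→ℚ (suc m) * 1ℚ - 1ℚ       ∎
    where
    pred-form : ∀ x → x ≡ (1ℚ + x) * 1ℚ - 1ℚ
    pred-form = Solver.solve-∀ ℚ-ring
  trace-value false = sym (trans (cong (_- 1ℚ) (ℚP.*-zeroʳ (ℕ→ℚ (suc m)))) (ℚP.+-identityˡ (- 1ℚ)))

trTimesPow-opposite : ∀ {m} (c : Fin m → ℚ) (j : Fin m) →
  trTimesPow (suc m) c (suc (toℕ j)) ≡ ℕ→ℚ (suc m) * c (opposite j) - sum c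
trTimesPow-opposite {m} c j = begin
  ΣFin m (λ i → c i * trPow (suc m) (suc (toℕ i) ℕ.+ suc (toℕ j)))
    ≡⟨ ΣFin≡sum m _ ⟩
  sum (λ i → c i * trPow (suc m) (suc (toℕ i) ℕ.+ suc (toℕ j)))
    ≡⟨ sum-cong-≗ (λ i → trans (cong (c i *_) (trPow-δ i j)) (distrib P (c i) (δ i k))) ⟩
  sum (λ i → P * (c i * δ i k) + - 1ℚ * c i)
    ≡⟨ ∑-distrib-+ (λ i → P * (c i * δ i k)) (λ i → - 1ℚ * c i) ⟩
  sum (λ i → P * (c i * δ i k)) + sum (λ i → - 1ℚ * c i)
    ≡⟨ cong₂ _+_ (sym (*-distribˡ-sum P (λ i → c i * δ i k))) (sym (*-distribˡ-sum (- 1ℚ) c)) ⟩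
  P * sum (λ i → c i * δ i k) + - 1ℚ * sum c
    ≡⟨ cong (λ x → P * x + - 1ℚ * sum c) (sum-δ c k) ⟩
  P * c k + - 1ℚ * sum c
    ≡⟨ cong (P * c k +_) (negate (sum c)) ⟩
  P * c k - sum c ∎
  where
  P = ℕ→ℚ (suc m)
  k = opposite j
  distrib : ∀ P x d → x * (P * d - 1ℚ) ≡ P * (x * d) + - 1ℚ * x
  distrib = Solver.solve-∀ ℚ-ring
  negate : ∀ x → - 1ℚ * x ≡ - x
  negate = Solver.solve-∀ ℚ-ring

normSq-formula : ∀ {m} (c : Fin m → ℚ) → let P = ℕ→ℚ (suc m) in
  normSq (suc m) c ≡ P * P * sum (λ i → c i * c i) - (P + 1ℚ) * sum c * sum c
normSq-formula {m} c = begin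
  normSq (suc m) c
    ≡⟨ ΣFin≡sum m _ ⟩
  sum {m} (λ j → trTimesPow (suc m) c (suc (toℕ j)) * trTimesPow (suc m) c (suc (toℕ j)))
    ≡⟨ sum-cong-≗ (λ j → cong (λ x → x * x) (trTimesPow-opposite c j)) ⟩
  sum (λ j → (P * c (opposite j) - S) * (P * c (opposite j) - S))
    ≡⟨ sym (∑-permute (λ j → (P * c j - S) * (P * c j - S)) reverse) ⟩
  sum (λ j → (P * c j - S) * (P * c j - S))
    ≡⟨ sum-affine² P (- S) c ⟩
  P * P * Q + ℕ→ℚ 2 * P * - S * S + ℕ→ℚ m * (- S * - S)
    ≡⟨ collect (ℕ→ℚ m) Q S (ℕ→ℚ-suc m) ⟩
  P * P * Q - (P + 1ℚ) * S * S ∎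
  where
  P = ℕ→ℚ (suc m)
  S = sum c
  Q = sum (λ i → c i * c i)
  collect : ∀ {P} M Q S → P ≡ 1ℚ + M →
    P * P * Q + ℕ→ℚ 2 * P * - S * S + M * (- S * - S) ≡ P * P * Q - (P + 1ℚ) * S * S
  collect M Q S refl = Solver.solve (M ∷ Q ∷ S ∷ []) ℚ-ring

-- With signs s, t ∈ {±1} encoded as booleans, signDiff s t = (t − s) / 2.
signDiff : Bool → Bool → ℚ
signDiff true  true  = 0ℚ
signDiff true  false = - 1ℚ
signDiff false true  = 1ℚ
signDiff false false = 0ℚ

Δ : ∀ {m} → Vec Bool m → Vec Bool m → Fin m → ℚ
Δ s t i = signDiff (lookup s i) (lookup t i)

ΣΔ² : ∀ {m} → Vec Bool m → Vec Bool m → ℚ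
ΣΔ² s t = sum (λ i → Δ s t i * Δ s t i)

ΣΔ : ∀ {m} → Vec Bool m → Vec Bool m → ℚ
ΣΔ s t = sum (Δ s t)

vElem-sub : ∀ p N (s t : Vec Bool (p ∸ 1)) i →
  vElem p N t i - vElem p N s i ≡ ℕ→ℚ 2 * ℕ→ℚ N * Δ s t i
vElem-sub p N s t i = sign-sub (ℕ→ℚ N) (lookup s i) (lookup t i)
  where
  x-x : ∀ n x → x - x ≡ ℕ→ℚ 2 * n * 0ℚ
  x-x = Solver.solve-∀ ℚ-ring
  -n-n : ∀ n → - n - n ≡ ℕ→ℚ 2 * n * - 1ℚ
  -n-n = Solver.solve-∀ ℚ-ring
  n+n : ∀ n → n - - n ≡ ℕ→ℚ 2 * n * 1ℚ
  n+n = Solver.solve-∀ ℚ-ring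
  sign-sub : ∀ n b b′ → (if b′ then n else - n) - (if b then n else - n) ≡ ℕ→ℚ 2 * n * signDiff b b′
  sign-sub n true  true  = x-x n n
  sign-sub n true  false = -n-n n
  sign-sub n false true  = n+n n
  sign-sub n false false = x-x n (- n)

normSq-signs : ∀ {m} N (s t : Vec Bool m) → let P = ℕ→ℚ (suc m); k = ℕ→ℚ 2 * ℕ→ℚ N in
  normSq (suc m) (λ i → vElem (suc m) N t i - vElem (suc m) N s i)
    ≡ k * k * (P * P * ΣΔ² s t - (P + 1ℚ) * ΣΔ s t * ΣΔ s t)
normSq-signs {m} N s t = begin
  normSq (suc m) c
    ≡⟨ normSq-formula c ⟩
  P * P * sum (λ i → c i * c i) - (P + 1ℚ) * sum c * sum c
    ≡⟨ cong₂ (λ Q S → P * P * Q - (P + 1ℚ) * S * S) sum-c² sum-c ⟩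
  P * P * (k * k * ΣΔ² s t) - (P + 1ℚ) * (k * ΣΔ s t) * (k * ΣΔ s t)
    ≡⟨ factor k P (ΣΔ² s t) (ΣΔ s t) ⟩
  k * k * (P * P * ΣΔ² s t - (P + 1ℚ) * ΣΔ s t * ΣΔ s t) ∎
  where
  P = ℕ→ℚ (suc m)
  k = ℕ→ℚ 2 * ℕ→ℚ N
  c : Fin m → ℚ
  c i = vElem (suc m) N t i - vElem (suc m) N s i
  sum-c : sum c ≡ k * ΣΔ s t
  sum-c = trans (sum-cong-≗ (vElem-sub (suc m) N s t)) (sym (*-distribˡ-sum k (Δ s t)))
  square-scale : ∀ k z → k * z * (k * z) ≡ k * k * (z * z)
  square-scale = Solver.solve-∀ ℚ-ring
  sum-c² : sum (λ i → c i * c i) ≡ k * k * ΣΔ² s t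
  sum-c² = trans
    (sum-cong-≗ (λ i → trans (cong (λ x → x * x) (vElem-sub (suc m) N s t i))
                             (square-scale k (Δ s t i))))
    (sym (*-distribˡ-sum (k * k) (λ i → Δ s t i * Δ s t i)))
  factor : ∀ k P A B →
    P * P * (k * k * A) - (P + 1ℚ) * (k * B) * (k * B) ≡ k * k * (P * P * A - (P + 1ℚ) * B * B)
  factor = Solver.solve-∀ ℚ-ring

ΣList-allSigns-suc : ∀ m (f : Vec Bool (suc m) → ℚ) →
  ΣList (allSigns (suc m)) f
    ≡ ΣList (allSigns m) (f ∘ (true Vec.∷_)) + ΣList (allSigns m) (f ∘ (false Vec.∷_))
ΣList-allSigns-suc m f = trans (ΣList-++ (List.map (true Vec.∷_) (allSigns m)) _ f)
  (cong₂ _+_ (ΣList-map (true Vec.∷_) (allSigns m) f) (ΣList-map (false Vec.∷_) (allSigns m) f))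

length-allSigns : ∀ m → length (allSigns m) ≡ 2 ^ m
length-allSigns zero    = refl
length-allSigns (suc m) = begin
  length (List.map (true Vec.∷_) (allSigns m) List.++ List.map (false Vec.∷_) (allSigns m))
    ≡⟨ ListP.length-++ (List.map (true Vec.∷_) (allSigns m)) ⟩
  length (List.map (true Vec.∷_) (allSigns m)) ℕ.+ length (List.map (false Vec.∷_) (allSigns m))
    ≡⟨ cong₂ ℕ._+_ (ListP.length-map (true Vec.∷_) (allSigns m))
                   (ListP.length-map (false Vec.∷_) (allSigns m)) ⟩
  length (allSigns m) ℕ.+ length (allSigns m)
    ≡⟨ cong (λ n → n ℕ.+ n) (length-allSigns m) ⟩
  2 ^ m ℕ.+ 2 ^ m
    ≡⟨ cong (2 ^ m ℕ.+_) (sym (ℕP.+-identityʳ (2 ^ m))) ⟩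
  2 ^ suc m ∎

cardV≢0 : ∀ p → cardV p ≢ 0ℚ
cardV≢0 p = subst (λ n → ℕ→ℚ n ≢ 0ℚ) (sym (length-allSigns (p ∸ 1)))
  (ℕ→ℚ≢0 (2 ^ (p ∸ 1)) {{ℕP.m^n≢0 2 (p ∸ 1)}})

ΣPairs : ∀ m → (Vec Bool m → Vec Bool m → ℚ) → ℚ
ΣPairs m f = ΣList (allSigns m) λ s → ΣList (allSigns m) (f s)

ΣPairs-cong : ∀ m {f g : Vec Bool m → Vec Bool m → ℚ} → (∀ s t → f s t ≡ g s t) → ΣPairs m f ≡ ΣPairs m g
ΣPairs-cong m f≗g = ΣList-cong (allSigns m) (λ s → ΣList-cong (allSigns m) (f≗g s))

ΣPairs-suc : ∀ m (f : Vec Bool (suc m) → Vec Bool (suc m) → ℚ) →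
  ΣPairs (suc m) f
    ≡ (ΣPairs m (λ s t → f (true Vec.∷ s) (true Vec.∷ t))
       + ΣPairs m (λ s t → f (true Vec.∷ s) (false Vec.∷ t)))
    + (ΣPairs m (λ s t → f (false Vec.∷ s) (true Vec.∷ t))
       + ΣPairs m (λ s t → f (false Vec.∷ s) (false Vec.∷ t)))
ΣPairs-suc m f = trans (ΣList-allSigns-suc m _) (cong₂ _+_ (split true) (split false))
  where
  split : ∀ b → ΣList (allSigns m) (λ s → ΣList (allSigns (suc m)) (f (b Vec.∷ s)))
              ≡ ΣPairs m (λ s t → f (b Vec.∷ s) (true Vec.∷ t))
                + ΣPairs m (λ s t → f (b Vec.∷ s) (false Vec.∷ t))
  split b = trans (ΣList-cong (allSigns m) (λ s → ΣList-allSigns-suc m (f (b Vec.∷ s))))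
                  (ΣList-+ (allSigns m) _ _)

pairCount : ℕ → ℚ
pairCount m = ΣPairs m (λ _ _ → 1ℚ)

pairCount≡cardV² : ∀ m → pairCount m ≡ cardV (suc m) * cardV (suc m)
pairCount≡cardV² m = begin
  ΣList L (λ _ → ΣList L (λ _ → 1ℚ))   ≡⟨ ΣList-cong L (λ _ → ΣList-const L 1ℚ) ⟩
  ΣList L (λ _ → K * 1ℚ)               ≡⟨ ΣList-const L (K * 1ℚ) ⟩
  K * (K * 1ℚ)                         ≡⟨ cong (K *_) (ℚP.*-identityʳ K) ⟩
  K * K                                ∎
  where
  L = allSigns m
  K = ℕ→ℚ (length L)

ΣPairs⊘cardV² : ∀ m {f x} → ΣPairs m f ≡ pairCount m * x →
  ΣPairs m f ⊘ (cardV (suc m) * cardV (suc m)) ≡ x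
ΣPairs⊘cardV² m {f} {x} ΣPairs≡ = ⊘-unique (*-≢0 (cardV≢0 (suc m)) (cardV≢0 (suc m))) (begin
  x * (cardV (suc m) * cardV (suc m))   ≡⟨ ℚP.*-comm x _ ⟩
  cardV (suc m) * cardV (suc m) * x     ≡⟨ cong (_* x) (sym (pairCount≡cardV² m)) ⟩
  pairCount m * x                       ≡⟨ sym ΣPairs≡ ⟩
  ΣPairs m f                            ∎)

moment : ∀ m → (ℚ → ℚ → ℚ) → ℚ
moment m F = ΣPairs m λ s t → F (ΣΔ² s t) (ΣΔ s t)

-- INLINE lets the ring solver, which treats applications of defined functions
-- as opaque constants, see the polynomials behind these definitions.
shift : ℚ → (ℚ → ℚ → ℚ) → ℚ → ℚ → ℚ
shift z F a b = F (z * z + a) (z + b)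
{-# INLINE shift #-}

-- The four sign pairs in a new coordinate have signDiff 0, −1, 1 and 0.
moment-suc : ∀ m F →
  moment (suc m) F
    ≡ (moment m (shift 0ℚ F) + moment m (shift (- 1ℚ) F)) + (moment m (shift 1ℚ F) + moment m (shift 0ℚ F))
moment-suc m F = ΣPairs-suc m _

MomentStep : (ℚ → ℚ → ℚ → ℚ) → ℚ → Set
MomentStep C α = ∀ M y γ →
  (C M (y + 0ℚ) (γ + α * 0ℚ * 0ℚ) + C M (y + - 1ℚ) (γ + α * - 1ℚ * - 1ℚ))
    + (C M (y + 1ℚ) (γ + α * 1ℚ * 1ℚ) + C M (y + 0ℚ) (γ + α * 0ℚ * 0ℚ))
  ≡ ℕ→ℚ 4 * C (1ℚ + M) y γ
{-# INLINE MomentStep #-}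

module _ (Φ : ℚ → ℚ → ℚ → ℚ → ℚ) (C : ℚ → ℚ → ℚ → ℚ) (α : ℚ)
         (Φ-shift : ∀ z y γ a b → shift z (Φ y γ) a b ≡ Φ (y + z) (γ + α * z * z) a b)
         (C-zero : ∀ y γ → Φ y γ 0ℚ 0ℚ ≡ C 0ℚ y γ)
         (C-step : MomentStep C α)
  where

  moment-closedForm : ∀ m y γ → moment m (Φ y γ) ≡ pairCount m * C (ℕ→ℚ m) y γ
  moment-closedForm zero y γ = begin
    Φ y γ 0ℚ 0ℚ + 0ℚ + 0ℚ   ≡⟨ trans (ℚP.+-identityʳ _) (ℚP.+-identityʳ _) ⟩
    Φ y γ 0ℚ 0ℚ             ≡⟨ C-zero y γ ⟩
    C 0ℚ y γ                ≡⟨ sym (ℚP.*-identityˡ (C 0ℚ y γ)) ⟩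
    1ℚ * C 0ℚ y γ           ∎
  moment-closedForm (suc m) y γ = begin
    moment (suc m) (Φ y γ)
      ≡⟨ moment-suc m (Φ y γ) ⟩
    (moment m (shift 0ℚ (Φ y γ)) + moment m (shift (- 1ℚ) (Φ y γ)))
      + (moment m (shift 1ℚ (Φ y γ)) + moment m (shift 0ℚ (Φ y γ)))
      ≡⟨ cong₂ _+_ (cong₂ _+_ (shifted 0ℚ) (shifted (- 1ℚ))) (cong₂ _+_ (shifted 1ℚ) (shifted 0ℚ)) ⟩
    (U * C′ 0ℚ + U * C′ (- 1ℚ)) + (U * C′ 1ℚ + U * C′ 0ℚ)
      ≡⟨ distrib U (C′ 0ℚ) (C′ (- 1ℚ)) (C′ 1ℚ) ⟩
    U * ((C′ 0ℚ + C′ (- 1ℚ)) + (C′ 1ℚ + C′ 0ℚ))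
      ≡⟨ cong (U *_) (C-step (ℕ→ℚ m) y γ) ⟩
    U * (ℕ→ℚ 4 * C (1ℚ + ℕ→ℚ m) y γ)
      ≡⟨ regroup U (C (1ℚ + ℕ→ℚ m) y γ) ⟩
    ((U + U) + (U + U)) * C (1ℚ + ℕ→ℚ m) y γ
      ≡⟨ cong₂ (λ u M → u * C M y γ) (sym (ΣPairs-suc m (λ _ _ → 1ℚ))) (sym (ℕ→ℚ-suc m)) ⟩
    pairCount (suc m) * C (ℕ→ℚ (suc m)) y γ ∎
    where
    U = pairCount m
    C′ : ℚ → ℚ
    C′ z = C (ℕ→ℚ m) (y + z) (γ + α * z * z)
    shifted : ∀ z → moment m (shift z (Φ y γ)) ≡ U * C′ z
    shifted z = trans (ΣPairs-cong m (λ s t → Φ-shift z y γ (ΣΔ² s t) (ΣΔ s t)))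
                      (moment-closedForm m (y + z) (γ + α * z * z))
    distrib : ∀ u a b c → (u * a + u * b) + (u * c + u * a) ≡ u * ((a + b) + (c + a))
    distrib = Solver.solve-∀ ℚ-ring
    regroup : ∀ u x → u * (ℕ→ℚ 4 * x) ≡ ((u + u) + (u + u)) * x
    regroup = Solver.solve-∀ ℚ-ring

quadForm : (α β y γ : ℚ) → ℚ → ℚ → ℚ
quadForm α β y γ a b = α * a + β * ((b + y) * (b + y)) + γ
{-# INLINE quadForm #-}

quadMean : (α β M y γ : ℚ) → ℚ
quadMean α β M y γ = α * M * ½ + β * (M * ½ + y * y) + γ
{-# INLINE quadMean #-}

quadVariance : (α β M y : ℚ) → ℚ
quadVariance α β M y =
  (α + β) * (α + β) * M * ½ * ½ + β * β * (M - 1ℚ) * M * ½ + ℕ→ℚ 2 * β * β * y * y * M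
{-# INLINE quadVariance #-}

quadSecondMoment : (α β M y γ : ℚ) → ℚ
quadSecondMoment α β M y γ = quadMean α β M y γ * quadMean α β M y γ + quadVariance α β M y
{-# INLINE quadSecondMoment #-}

quadForm-shift : ∀ α β z y γ a b →
  shift z (quadForm α β y γ) a b ≡ quadForm α β (y + z) (γ + α * z * z) a b
quadForm-shift = Solver.solve-∀ ℚ-ring

quadMean-zero : ∀ α β y γ → quadForm α β y γ 0ℚ 0ℚ ≡ quadMean α β 0ℚ y γ
quadMean-zero = Solver.solve-∀ ℚ-ring

quadMean-step : ∀ α β → MomentStep (quadMean α β) α
quadMean-step = Solver.solve-∀ ℚ-ring

quadSecondMoment-zero : ∀ α β y γ →
  quadForm α β y γ 0ℚ 0ℚ * quadForm α β y γ 0ℚ 0ℚ ≡ quadSecondMoment α β 0ℚ y γ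
quadSecondMoment-zero = Solver.solve-∀ ℚ-ring

quadSecondMoment-step : ∀ α β → MomentStep (quadSecondMoment α β) α
quadSecondMoment-step = Solver.solve-∀ ℚ-ring

quadSecondMoment-centred : ∀ α β M y γ →
  quadSecondMoment α β M y (γ - quadMean α β M y γ) ≡ quadVariance α β M y
quadSecondMoment-centred = Solver.solve-∀ ℚ-ring

moment-quadForm : ∀ α β m y γ → moment m (quadForm α β y γ) ≡ pairCount m * quadMean α β (ℕ→ℚ m) y γ
moment-quadForm α β =
  moment-closedForm (quadForm α β) (quadMean α β) α
    (quadForm-shift α β) (quadMean-zero α β) (quadMean-step α β)

moment-quadForm² : ∀ α β m y γ →
  moment m (λ a b → quadForm α β y γ a b * quadForm α β y γ a b)
    ≡ pairCount m * quadSecondMoment α β (ℕ→ℚ m) y γ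
moment-quadForm² α β =
  moment-closedForm (λ y γ a b → quadForm α β y γ a b * quadForm α β y γ a b) (quadSecondMoment α β) α
    (λ z y γ a b → cong (λ x → x * x) (quadForm-shift α β z y γ a b))
    (quadSecondMoment-zero α β) (quadSecondMoment-step α β)

quadForm-sub : ∀ α β y γ μ a b → quadForm α β y γ a b - μ ≡ quadForm α β y (γ - μ) a b
quadForm-sub = Solver.solve-∀ ℚ-ring

quadVariance-d² : ∀ {P} c M → P ≡ 1ℚ + M →
  quadVariance (c * P * P) (- (c * (P + 1ℚ))) M 0ℚ
    ≡ c * c * M * (P * P * P * P - P * P - ℕ→ℚ 4 * P - ℕ→ℚ 3) * ½ * ½
quadVariance-d² c M refl = Solver.solve (c ∷ M ∷ []) ℚ-ring

dSq-expand : ∀ c P M n A B →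
  quadForm (c * P * P) (- (c * (P + 1ℚ))) 0ℚ 0ℚ A B * (ℕ→ℚ 4 * n * n * P * P * M)
    ≡ ℕ→ℚ 2 * n * (ℕ→ℚ 2 * n) * (P * P * A - (P + 1ℚ) * B * B) * (c * (P * P * M))
dSq-expand = Solver.solve-∀ ℚ-ring

module WithInverses {P M i j : ℚ} (iP≡1 : i * P ≡ 1ℚ) (jM≡1 : j * M ≡ 1ℚ) where

  inverse-product : i * i * j * (P * P * M) ≡ 1ℚ
  inverse-product = begin
    i * i * j * (P * P * M)       ≡⟨ Solver.solve (i ∷ P ∷ j ∷ M ∷ []) ℚ-ring ⟩
    i * P * (i * P) * (j * M)     ≡⟨ cong₂ (λ u v → u * u * v) iP≡1 jM≡1 ⟩
    1ℚ * 1ℚ * 1ℚ                  ∎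

  inverse-identity :
    i * i * j * (i * i * j) * M * (P * P * P * P - P * P - ℕ→ℚ 4 * P - ℕ→ℚ 3) * ½ * ½
      ≡ ½ * ½ * j * (1ℚ - i * i - ℕ→ℚ 4 * (i * i * i) - ℕ→ℚ 3 * (i * i * i * i))
  inverse-identity = begin
    i * i * j * (i * i * j) * M * (P * P * P * P - P * P - ℕ→ℚ 4 * P - ℕ→ℚ 3) * ½ * ½
      ≡⟨ Solver.solve (i ∷ P ∷ j ∷ M ∷ []) ℚ-ring ⟩
    ½ * ½ * j * (j * M) * (i * P * (i * P) * (i * P) * (i * P) - i * i * (i * P * (i * P))
      - ℕ→ℚ 4 * (i * i * i) * (i * P) - ℕ→ℚ 3 * (i * i * i * i))
      ≡⟨ cong₂ (λ u v → ½ * ½ * j * v * (u * u * u * u - i * i * (u * u) - ℕ→ℚ 4 * (i * i * i) * u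
                                            - ℕ→ℚ 3 * (i * i * i * i))) iP≡1 jM≡1 ⟩
    ½ * ½ * j * 1ℚ * (1ℚ - i * i * 1ℚ - ℕ→ℚ 4 * (i * i * i) * 1ℚ - ℕ→ℚ 3 * (i * i * i * i))
      ≡⟨ Solver.solve (i ∷ j ∷ []) ℚ-ring ⟩
    ½ * ½ * j * (1ℚ - i * i - ℕ→ℚ 4 * (i * i * i) - ℕ→ℚ 3 * (i * i * i * i)) ∎

  rhs-inverses : P ≢ 0ℚ → M ≢ 0ℚ →
    (1ℚ ⊘ (ℕ→ℚ 4 * M)) * (1ℚ - 1ℚ ⊘ (P * P) - ℕ→ℚ 4 ⊘ (P * P * P) - ℕ→ℚ 3 ⊘ (P * P * P * P))
      ≡ ½ * ½ * j * (1ℚ - i * i - ℕ→ℚ 4 * (i * i * i) - ℕ→ℚ 3 * (i * i * i * i))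
  rhs-inverses P≢0 M≢0 = cong₂ _*_
    (⊘-unique {z = ½ * ½ * j} (*-≢0 (ℕ→ℚ≢0 4) M≢0) quarter-j)
    (cong₂ _-_ (cong₂ _-_ (cong (λ x → 1ℚ - x) (⊘-unique {z = i * i} P²≢0 i²P²))
                          (⊘-unique {z = ℕ→ℚ 4 * (i * i * i)} P³≢0 i³P³))
               (⊘-unique {z = ℕ→ℚ 3 * (i * i * i * i)} P⁴≢0 i⁴P⁴))
    where
    P²≢0 = *-≢0 P≢0 P≢0
    P³≢0 = *-≢0 P²≢0 P≢0
    P⁴≢0 = *-≢0 P³≢0 P≢0
    quarter-j : ½ * ½ * j * (ℕ→ℚ 4 * M) ≡ 1ℚ
    quarter-j = begin
      ½ * ½ * j * (ℕ→ℚ 4 * M)   ≡⟨ Solver.solve (j ∷ M ∷ []) ℚ-ring ⟩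
      j * M                     ≡⟨ jM≡1 ⟩
      1ℚ                        ∎
    i²P² : i * i * (P * P) ≡ 1ℚ
    i²P² = begin
      i * i * (P * P)           ≡⟨ Solver.solve (i ∷ P ∷ []) ℚ-ring ⟩
      i * P * (i * P)           ≡⟨ cong (λ u → u * u) iP≡1 ⟩
      1ℚ                        ∎
    i³P³ : ℕ→ℚ 4 * (i * i * i) * (P * P * P) ≡ ℕ→ℚ 4
    i³P³ = begin
      ℕ→ℚ 4 * (i * i * i) * (P * P * P)     ≡⟨ Solver.solve (i ∷ P ∷ []) ℚ-ring ⟩
      ℕ→ℚ 4 * (i * P * (i * P) * (i * P))   ≡⟨ cong (λ u → ℕ→ℚ 4 * (u * u * u)) iP≡1 ⟩
      ℕ→ℚ 4                                 ∎
    i⁴P⁴ : ℕ→ℚ 3 * (i * i * i * i) * (P * P * P * P) ≡ ℕ→ℚ 3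
    i⁴P⁴ = begin
      ℕ→ℚ 3 * (i * i * i * i) * (P * P * P * P)       ≡⟨ Solver.solve (i ∷ P ∷ []) ℚ-ring ⟩
      ℕ→ℚ 3 * (i * P * (i * P) * (i * P) * (i * P))   ≡⟨ cong (λ u → ℕ→ℚ 3 * (u * u * u * u)) iP≡1 ⟩
      ℕ→ℚ 3                                           ∎

module _ (m N : ℕ) where

  private
    p = suc (suc m)
    P = ℕ→ℚ p
    M = ℕ→ℚ (suc m)
    n = ℕ→ℚ (suc N)
    P≢0 = ℕ→ℚ≢0 p
    M≢0 = ℕ→ℚ≢0 (suc m)
    i = 1ℚ ⊘ P
    j = 1ℚ ⊘ M
    iP≡1 = ⊘-inverseˡ P≢0
    jM≡1 = ⊘-inverseˡ M≢0
    c = i * i * j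
    α = c * P * P
    β = - (c * (P + 1ℚ))
    μ = quadMean α β M 0ℚ 0ℚ
    d² : Vec Bool (suc m) → Vec Bool (suc m) → ℚ
    d² s t = dSq p (suc N) (vElem p (suc N) s) (vElem p (suc N) t)

  open WithInverses {P} {M} {i} {j} iP≡1 jM≡1

  dSq≡quadForm : ∀ s t → d² s t ≡ quadForm α β 0ℚ 0ℚ (ΣΔ² s t) (ΣΔ s t)
  dSq≡quadForm s t = ⊘-unique D≢0 (begin
    quadForm α β 0ℚ 0ℚ (ΣΔ² s t) (ΣΔ s t) * D   ≡⟨ dSq-expand c P M n (ΣΔ² s t) (ΣΔ s t) ⟩
    k * k * X * (c * (P * P * M))               ≡⟨ cong (k * k * X *_) inverse-product ⟩
    k * k * X * 1ℚ                              ≡⟨ ℚP.*-identityʳ (k * k * X) ⟩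
    k * k * X                                   ≡⟨ sym (normSq-signs (suc N) s t) ⟩
    normSq p (λ i → vElem p (suc N) t i - vElem p (suc N) s i) ∎)
    where
    D = ℕ→ℚ 4 * n * n * P * P * M
    D≢0 = *-≢0 (*-≢0 (*-≢0 (*-≢0 (*-≢0 (ℕ→ℚ≢0 4) (ℕ→ℚ≢0 (suc N))) (ℕ→ℚ≢0 (suc N))) P≢0) P≢0) M≢0
    k = ℕ→ℚ 2 * n
    X = P * P * ΣΔ² s t - (P + 1ℚ) * ΣΔ s t * ΣΔ s t

  meanDSq≡quadMean : meanDSq p (suc N) ≡ μ
  meanDSq≡quadMean = ΣPairs⊘cardV² (suc m)
    (trans (ΣPairs-cong (suc m) dSq≡quadForm) (moment-quadForm α β (suc m) 0ℚ 0ℚ))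

  varDSq≡quadVariance : varDSq p (suc N) ≡ quadVariance α β M 0ℚ
  varDSq≡quadVariance = ΣPairs⊘cardV² (suc m) (begin
    ΣPairs (suc m) (λ s t → let x = d² s t - meanDSq p (suc N) in x * x)
      ≡⟨ ΣPairs-cong (suc m) (λ s t → cong (λ x → x * x) (centre s t)) ⟩
    moment (suc m) (λ a b → quadForm α β 0ℚ (0ℚ - μ) a b * quadForm α β 0ℚ (0ℚ - μ) a b)
      ≡⟨ moment-quadForm² α β (suc m) 0ℚ (0ℚ - μ) ⟩
    pairCount (suc m) * quadSecondMoment α β M 0ℚ (0ℚ - μ)
      ≡⟨ cong (pairCount (suc m) *_) (quadSecondMoment-centred α β M 0ℚ 0ℚ) ⟩
    pairCount (suc m) * quadVariance α β M 0ℚ ∎)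
    where
    centre : ∀ s t → d² s t - meanDSq p (suc N) ≡ quadForm α β 0ℚ (0ℚ - μ) (ΣΔ² s t) (ΣΔ s t)
    centre s t = trans (cong₂ _-_ (dSq≡quadForm s t) meanDSq≡quadMean)
                       (quadForm-sub α β 0ℚ 0ℚ μ (ΣΔ² s t) (ΣΔ s t))

  rhs≡quadVariance : rhs p ≡ quadVariance α β M 0ℚ
  rhs≡quadVariance = begin
    rhs p
      ≡⟨ rhs-inverses P≢0 M≢0 ⟩
    ½ * ½ * j * (1ℚ - i * i - ℕ→ℚ 4 * (i * i * i) - ℕ→ℚ 3 * (i * i * i * i))
      ≡⟨ sym inverse-identity ⟩
    c * c * M * (P * P * P * P - P * P - ℕ→ℚ 4 * P - ℕ→ℚ 3) * ½ * ½
      ≡⟨ sym (quadVariance-d² c M (ℕ→ℚ-suc (suc m))) ⟩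
    quadVariance α β M 0ℚ ∎

  varDSq≡rhs : varDSq (suc (suc m)) (suc N) ≡ rhs (suc (suc m))
  varDSq≡rhs = trans varDSq≡quadVariance (sym rhs≡quadVariance)

lemma7 : (p N : ℕ) → Prime p → ¬ (2 ∣ p) → 1 ≤ N →
    varDSq p N ≡ rhs p
lemma7 zero                N       p-prime _ _ = ⊥-elim (¬prime[0] p-prime)
lemma7 (suc zero)          N       p-prime _ _ = ⊥-elim (¬prime[1] p-prime)
lemma7 (suc (suc m))       zero    _       _ ()
lemma7 (suc (suc m))       (suc N) _       _ _ = varDSq≡rhs m N
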